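{- Let $\lambda\vdash n$, $1\le k\le n$ and $S\in\operatorname{SYT}(\lambda)$. Then $I\mapsto\vec h^S_I$ is a bijection from the set of subsets $I$ with $\operatorname{Dsi}^c(S)\subseteq I\subseteq\mathbb{N}_{n-1}$ and $|I|=k-1$ onto $H^S_k$. Similarly, for $C\in\operatorname{CCT}(\lambda)$, $I\mapsto\vec h_C^I$ is a bijection from the set of subsets $I$ with $\operatorname{Dsp}^c(C)\subseteq I\subseteq\mathbb{N}_{n-1}$ and $|I|=k-1$ onto $H_C^k$.
   Context: $\mathbb{N}_m=\{1,\dots,m\}$. Tableaux are in English notation; $\operatorname{SYT}(\lambda)$ = standard tableaux of shape $\lambda\vdash n$ with entries $\mathbb{N}_n$. For $S\in\operatorname{SYT}(\lambda)$, $\operatorname{Dsi}(S)$ is the set of $i\in\mathbb{N}_{n-1}$ such that $i+1$ is in a strictly lower row and a weakly left column than $i$, and $\operatorname{Dsi}^c(S)=\{n-i:i\in\operatorname{Dsi}(S)\}$. A generalized cocharge tableau is a semistandard filling (rows weakly increasing, columns strictly increasing) by nonnegative integers with value set $\{0,\dots,k'-1\}$; if $h$ occurs $\alpha_h$ times its type is $J=\{\alpha_0,\alpha_0+\alpha_1,\dots,\alpha_0+\dots+\alpha_{k'-2}\}$. $\operatorname{CCT}(\lambda)$ is the set of such tableaux of shape $\lambda$ for which, for every $h>0$ occurring, the leftmost box containing $h$ has a box containing $h-1$ in a strictly higher row; for such $C$ of type $J$, $\operatorname{Dsp}^c(C)=\{n-i:i\in J\}$. For $I\subseteq\mathbb{N}_{n-1}$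 and $i\in I$, $r_i=|\{j\in\mathbb{N}_{n-1}\setminus I:j<i\}|$. If $\operatorname{Dsi}^c(S)\subseteq I$, $\vec h^S_I=(h_r)_{r=1}^n$ with $h_r=|\{i\in I\setminus\operatorname{Dsi}^c(S):r_i=r\}|$; if $\operatorname{Dsp}^c(C)\subseteq I$, $\vec h_C^I=(h_r)_{r=1}^n$ with $h_r=|\{i\in I\setminus\operatorname{Dsp}^c(C):r_i=r\}|$. $H^S_k$ is the set of vectors $(h_r)_{r=1}^n$ of nonnegative integers with $h_r=0$ for $r>n-k$ and $\sum_{r=1}^{n-k}h_r<k-|\operatorname{Dsi}^c(S)|$; $H^k_C$ is defined the same way with $|\operatorname{Dsp}^c(C)|$ in place of $|\operatorname{Dsi}^c(S)|$. -}

module Defs where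

open import Data.Bool using (Bool; true; false; _∧_; _∨_; not; if_then_else_)
open import Data.Nat using (ℕ; zero; suc; _+_; _∸_; _≤_; _<_; _⊔_; _<ᵇ_; _≡ᵇ_; _≤ᵇ_)
open import Data.Nat.ListAction using (sum)
open import Data.Bool.ListAction using (any)
open import Data.Fin using (Fin; toℕ)
open import Data.Fin.Subset using (Subset; ∣_∣; ∁; _∩_; _─_)
open import Data.List as List using (List; []; _∷_; concat; upTo; length)
open import Data.List.Relation.Unary.All using (All)
open import Data.List.Relation.Unary.Linked using (Linked)
open import Data.List.Membership.Propositional using (_∈_)
open import Data.List.Relation.Binary.Permutation.Propositional using (_↭_)
open import Data.Maybe using (Maybe; just; nothing)
open import Data.Product using (Σ; _×_; _,_; ∃)
open import Data.Vec as Vec using (Vec; tabulate; toList; lookup)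
open import Relation.Binary.PropositionalEquality using (_≡_)

record _⊢_ (lam : List ℕ) (n : ℕ) : Set where
  field
    positive   : All (λ x → 1 ≤ x) lam
    decreasing : Linked (λ a b → b ≤ a) lam
    sums       : sum lam ≡ n

-- Tableaux (English notation) as lists of rows; row 0 is the top row,
-- column 0 the leftmost column.

Tableau : Set
Tableau = List (List ℕ)

shape : Tableau → List ℕ
shape = List.map length

_!?_ : {A : Set} → List A → ℕ → Maybe A
[]       !? _     = nothing
(x ∷ xs) !? zero  = just x
(x ∷ xs) !? suc i = xs !? i

cell : Tableau → ℕ → ℕ → Maybe ℕ
cell T r c with T !? r
... | just row = row !? c
... | nothing  = nothing

ColStrict : Tableau → Set
ColStrict T = ∀ r c y → cell T (suc r) c ≡ just y →
              Σ ℕ λ x → cell T r c ≡ just x × x < y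

record SYT (n : ℕ) (lam : List ℕ) (S : Tableau) : Set where
  field
    hasShape : shape S ≡ lam
    rows     : All (Linked _<_) S
    cols     : ColStrict S
    entries  : concat S ↭ List.map suc (upTo n)

posRow : ℕ → List ℕ → Maybe ℕ
posRow v [] = nothing
posRow v (x ∷ xs) = if x ≡ᵇ v then just 0 else Data.Maybe.map suc (posRow v xs)
  where import Data.Maybe

pos : ℕ → Tableau → Maybe (ℕ × ℕ)
pos v [] = nothing
pos v (row ∷ T) with posRow v row
... | just c  = just (0 , c)
... | nothing = Data.Maybe.map (λ { (r , c) → (suc r , c) }) (pos v T)
  where import Data.Maybe

isDsi : Tableau → ℕ → Bool
isDsi S i with pos i S | pos (suc i) S
... | just (r , c) | just (r' , c') = (r <ᵇ r') ∧ (c' ≤ᵇ c)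
... | _            | _              = false

-- Subsets of N_{n-1} are represented as  Subset (n ∸ 1);
-- the index j : Fin (n ∸ 1) stands for the integer  toℕ j + 1.

-- Dsi^c(S) = { n - i : i ∈ Dsi(S) } :  j+1 ∈ Dsi^c(S)  iff  n-(j+1) ∈ Dsi(S)
DsiC : (n : ℕ) → Tableau → Subset (n ∸ 1)
DsiC n S = tabulate (λ j → isDsi S (n ∸ suc (toℕ j)))

record GCT (lam : List ℕ) (C : Tableau) : Set where
  field
    hasShape    : shape C ≡ lam
    rows        : All (Linked _≤_) C
    cols        : ColStrict C
    valuesInit  : ∀ v → v ∈ concat C → ∀ u → u ≤ v → u ∈ concat C

record CCT (lam : List ℕ) (C : Tableau) : Set where
  field
    gct      : GCT lam C
    cocharge : ∀ h r c → cell C r c ≡ just (suc h) →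
               (∀ r' c' → cell C r' c' ≡ just (suc h) → c ≤ c') →
               Σ ℕ λ r'' → Σ ℕ λ c'' → r'' < r × cell C r'' c'' ≡ just h

countBelow : Tableau → ℕ → ℕ
countBelow C h = length (List.filter (λ x → x Data.Nat.<? h) (concat C))
  where import Data.Nat

maxEntry : Tableau → ℕ
maxEntry C = List.foldr _⊔_ 0 (concat C)

-- i ∈ J (type of C) iff i = α_0 + … + α_{h-1} for some 1 ≤ h ≤ k'-1
inType : Tableau → ℕ → Bool
inType C i = any (λ h → countBelow C h ≡ᵇ i) (List.map suc (upTo (maxEntry C)))

-- Dsp^c(C) = { n - i : i ∈ J }
DspC : (n : ℕ) → Tableau → Subset (n ∸ 1)
DspC n C = tabulate (λ j → inType C (n ∸ suc (toℕ j)))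

rIdx : {m : ℕ} → Subset m → Fin m → ℕ
rIdx I i = ∣ ∁ I ∩ tabulate (λ j → toℕ j <ᵇ toℕ i) ∣

-- hVec n D I = (h_r)_{r=1}^n, h_r = |{ i ∈ I \ D : r_i = r }|;
-- the index r : Fin n stands for the integer toℕ r + 1.
hVec : (n : ℕ) → Subset (n ∸ 1) → Subset (n ∸ 1) → Vec ℕ n
hVec n D I = tabulate (λ r → ∣ (I ─ D) ∩ tabulate (λ i → rIdx I i ≡ᵇ suc (toℕ r)) ∣)

InH : (n k d : ℕ) → Vec ℕ n → Set
InH n k d v = (∀ (r : Fin n) → n ∸ k < suc (toℕ r) → lookup v r ≡ 0)
            × sum (List.take (n ∸ k) (toList v)) < k ∸ d

BijOnto : (n k : ℕ) → Subset (n ∸ 1) → Set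
BijOnto n k D =
    (∀ I → D Data.Fin.Subset.⊆ I → ∣ I ∣ ≡ k ∸ 1 → InH n k ∣ D ∣ (hVec n D I))
  × (∀ I I' → D Data.Fin.Subset.⊆ I → ∣ I ∣ ≡ k ∸ 1 →
              D Data.Fin.Subset.⊆ I' → ∣ I' ∣ ≡ k ∸ 1 →
              hVec n D I ≡ hVec n D I' → I ≡ I')
  × (∀ v → InH n k ∣ D ∣ v →
       Σ (Subset (n ∸ 1)) λ I → D Data.Fin.Subset.⊆ I × ∣ I ∣ ≡ k ∸ 1 × hVec n D I ≡ v)
  where import Data.Fin.Subset

{-# OPTIONS --safe #-}

-- Walking through ℕ_{n-1}, the elements outside I cut it into |∁ I| + 1
-- gaps, and h_r counts the elements of I ∖ D lying in gap number r.  For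
-- D ⊆ I this identifies I with the weak composition (h_0, h_1, …) of
-- |I| - |D| into |∁ I| + 1 parts; |I| = k - 1 fixes the number of parts
-- to n - k + 1.  The vector h_I drops h_0, which is recovered as the slack
-- in the inequality defining H_k.  The tableau only enters through D, and
-- the bijection holds for every D.

module Submission where

open import Defs
open import Data.Nat using (ℕ; zero; suc; _+_; _∸_; _≤_; _<_; z≤n; s≤s; _≡ᵇ_)
open import Data.Nat.Properties
open import Data.Nat.ListAction using (sum)
open import Data.List using (List; take)
open import Data.Fin using (toℕ; zero; suc)
open import Data.Fin.Subset using (Subset; inside; outside; ∣_∣; ∁; _∩_; _─_; _⊆_)
open import Data.Fin.Subset.Properties using (drop-∷-⊆; in⊆in; out⊆; ∣∁p∣≡n∸∣p∣; ∣p∣≤n)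
open import Data.Vec using (Vec; []; _∷_; tabulate; lookup; toList; here)
open import Data.Vec.Properties using (tabulate-cong; lookup∘tabulate)
open import Data.Product using (Σ; _×_; _,_; proj₁; proj₂)
open import Function using (_∘_)
open import Algebra.Properties.CommutativeSemigroup +-commutativeSemigroup using (xy∙z≈xz∙y)
open import Relation.Binary.PropositionalEquality

private
  variable
    m N : ℕ

m<o∸n⇒m+n<o : ∀ {m n o} → m < o ∸ n → m + n < o
m<o∸n⇒m+n<o {m} {n} {o} m<o∸n = m≤o∸n⇒m+n≤o (suc m) (<⇒≤ n<o) m<o∸n
  where
  n<o : n < o
  n<o = m∸n≢0⇒n<m (λ o∸n≡0 → n≮0 (subst (m <_) o∸n≡0 m<o∸n))

sumBelow : ℕ → (ℕ → ℕ) → ℕ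
sumBelow zero    f = 0
sumBelow (suc z) f = f 0 + sumBelow z (f ∘ suc)

sumBelow-cong : ∀ z {f g : ℕ → ℕ} → (∀ r → r < z → f r ≡ g r) → sumBelow z f ≡ sumBelow z g
sumBelow-cong zero    _   = refl
sumBelow-cong (suc z) f≡g =
  cong₂ _+_ (f≡g 0 (s≤s z≤n)) (sumBelow-cong z (λ r r<z → f≡g (suc r) (s≤s r<z)))

infixl 10 _‼_

_‼_ : Vec ℕ N → ℕ → ℕ
[]      ‼ _     = 0
(x ∷ v) ‼ zero  = x
(x ∷ v) ‼ suc r = v ‼ r

tabulate-‼ : (v : Vec ℕ N) → tabulate (λ r → v ‼ toℕ r) ≡ v
tabulate-‼ []      = refl
tabulate-‼ (x ∷ v) = cong (x ∷_) (tabulate-‼ v)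

‼-tabulate : ∀ (g : ℕ → ℕ) {r} → r < N → tabulate {n = N} (g ∘ toℕ) ‼ r ≡ g r
‼-tabulate g {zero}  (s≤s _)   = refl
‼-tabulate g {suc r} (s≤s r<N) = ‼-tabulate (g ∘ suc) r<N

‼-vanishes : ∀ {z} (v : Vec ℕ N) → (∀ r → z ≤ toℕ r → lookup v r ≡ 0) →
             ∀ r → z ≤ r → v ‼ r ≡ 0
‼-vanishes []      _ _       _         = refl
‼-vanishes (x ∷ v) h zero    z≤0       = h zero z≤0
‼-vanishes {z = zero}  (x ∷ v) h (suc r) _ = ‼-vanishes v (λ i _ → h (suc i) z≤n) r z≤n
‼-vanishes {z = suc z} (x ∷ v) h (suc r) (s≤s z≤r) =
  ‼-vanishes v (λ i z≤i → h (suc i) (s≤s z≤i)) r z≤r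

sum-take-tabulate : ∀ (g : ℕ → ℕ) {z} → z ≤ N →
                    sum (take z (toList (tabulate {n = N} (g ∘ toℕ)))) ≡ sumBelow z g
sum-take-tabulate g z≤n       = refl
sum-take-tabulate g (s≤s z≤N) = cong (g 0 +_) (sum-take-tabulate (g ∘ suc) z≤N)

-- H_k on the sequence r ↦ h_{r+1}
InHSeq : (N k d : ℕ) → (ℕ → ℕ) → Set
InHSeq N k d g = (∀ r → N ∸ k ≤ r → g r ≡ 0) × sumBelow (N ∸ k) g + d < k

InHSeq⇒InH-tabulate : ∀ {N k d} (g : ℕ → ℕ) → InHSeq N k d g → InH N k d (tabulate (g ∘ toℕ))
InHSeq⇒InH-tabulate {N} {k} {d} g (g≡0 , S+d<k) =
  (λ r z<r → trans (lookup∘tabulate (g ∘ toℕ) r) (g≡0 (toℕ r) (≤-pred z<r))) ,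
  subst (_< k ∸ d) (sym (sum-take-tabulate g (m∸n≤m N k))) (m+n≤o⇒m≤o∸n (suc _) S+d<k)

InH⇒InHSeq-‼ : ∀ {N k d} (v : Vec ℕ N) → InH N k d v → InHSeq N k d (v ‼_)
InH⇒InHSeq-‼ {N} {k} {d} v (v≡0 , S<k∸d) =
  ‼-vanishes v (λ r z≤r → v≡0 r (s≤s z≤r)) ,
  m<o∸n⇒m+n<o (subst (_< k ∸ d) sum≡S S<k∸d)
  where
  sum≡S : sum (take (N ∸ k) (toList v)) ≡ sumBelow (N ∸ k) (v ‼_)
  sum≡S = trans (cong (sum ∘ take (N ∸ k) ∘ toList) (sym (tabulate-‼ v)))
                (sum-take-tabulate (v ‼_) (m∸n≤m N k))

infix 4 _⊆′_

data _⊆′_ : Subset m → Subset m → Set where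
  []   : [] ⊆′ []
  keep : {D I : Subset m} → D ⊆′ I → inside  ∷ D ⊆′ inside  ∷ I
  add  : {D I : Subset m} → D ⊆′ I → outside ∷ D ⊆′ inside  ∷ I
  skip : {D I : Subset m} → D ⊆′ I → outside ∷ D ⊆′ outside ∷ I

⊆⇒⊆′ : {D I : Subset m} → D ⊆ I → D ⊆′ I
⊆⇒⊆′ {D = []}          {[]}          _   = []
⊆⇒⊆′ {D = inside  ∷ D} {inside  ∷ I} D⊆I = keep (⊆⇒⊆′ (drop-∷-⊆ D⊆I))
⊆⇒⊆′ {D = inside  ∷ D} {outside ∷ I} D⊆I with D⊆I here
... | ()
⊆⇒⊆′ {D = outside ∷ D} {inside  ∷ I} D⊆I = add  (⊆⇒⊆′ (drop-∷-⊆ D⊆I))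
⊆⇒⊆′ {D = outside ∷ D} {outside ∷ I} D⊆I = skip (⊆⇒⊆′ (drop-∷-⊆ D⊆I))

⊆′⇒⊆ : {D I : Subset m} → D ⊆′ I → D ⊆ I
⊆′⇒⊆ []       = λ ()
⊆′⇒⊆ (keep s) = in⊆in (⊆′⇒⊆ s)
⊆′⇒⊆ (add s)  = out⊆ (⊆′⇒⊆ s)
⊆′⇒⊆ (skip s) = out⊆ (⊆′⇒⊆ s)

hSeq : Subset m → Subset m → ℕ → ℕ
hSeq []            []            _       = 0
hSeq (_ ∷ D)       (outside ∷ I) zero    = 0
hSeq (_ ∷ D)       (outside ∷ I) (suc r) = hSeq D I r
hSeq (inside ∷ D)  (inside ∷ I)  r       = hSeq D I r
hSeq (outside ∷ D) (inside ∷ I)  zero    = suc (hSeq D I zero)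
hSeq (outside ∷ D) (inside ∷ I)  (suc r) = hSeq D I (suc r)

hSeq-vanishes : ∀ (D I : Subset m) r → ∣ ∁ I ∣ < r → hSeq D I r ≡ 0
hSeq-vanishes []            []            _       _         = refl
hSeq-vanishes (_ ∷ D)       (outside ∷ I) (suc r) (s≤s c<r) = hSeq-vanishes D I r c<r
hSeq-vanishes (inside ∷ D)  (inside ∷ I)  r       c<r       = hSeq-vanishes D I r c<r
hSeq-vanishes (outside ∷ D) (inside ∷ I)  (suc r) c<r       = hSeq-vanishes D I (suc r) c<r

hSeq-total : {D I : Subset m} → D ⊆′ I →
             hSeq D I 0 + sumBelow ∣ ∁ I ∣ (hSeq D I ∘ suc) + ∣ D ∣ ≡ ∣ I ∣
hSeq-total []       = refl
hSeq-total (keep s) = trans (+-suc _ _) (cong suc (hSeq-total s))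
hSeq-total (add s)  = cong suc (hSeq-total s)
hSeq-total (skip s) = hSeq-total s

hSeq-injective : {D I I′ : Subset m} → D ⊆′ I → D ⊆′ I′ →
                 (∀ r → r ≤ ∣ ∁ I ∣ → hSeq D I r ≡ hSeq D I′ r) → I ≡ I′
hSeq-injective []       []        _   = refl
hSeq-injective (keep s) (keep s′) h≡h = cong (inside ∷_) (hSeq-injective s s′ h≡h)
hSeq-injective (add s)  (add s′)  h≡h = cong (inside ∷_) (hSeq-injective s s′ λ
  { zero    r≤c → suc-injective (h≡h zero r≤c)
  ; (suc r) r≤c → h≡h (suc r) r≤c })
hSeq-injective (skip s) (skip s′) h≡h =
  cong (outside ∷_) (hSeq-injective s s′ (λ r r≤c → h≡h (suc r) (s≤s r≤c)))
hSeq-injective (add s)  (skip s′) h≡h with h≡h zero z≤n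
... | ()
hSeq-injective (skip s) (add s′)  h≡h with h≡h zero z≤n
... | ()

-- hSeq⁻¹ D x t decodes the sequence x, t 0, t 1, …: x is the number of
-- elements of I ∖ D still to be placed in the current gap.
hSeq⁻¹ : Subset m → ℕ → (ℕ → ℕ) → Subset m
hSeq⁻¹ []            _       _ = []
hSeq⁻¹ (inside ∷ D)  x       t = inside ∷ hSeq⁻¹ D x t
hSeq⁻¹ (outside ∷ D) zero    t = outside ∷ hSeq⁻¹ D (t 0) (t ∘ suc)
hSeq⁻¹ (outside ∷ D) (suc x) t = inside ∷ hSeq⁻¹ D x t

⊆′-hSeq⁻¹ : ∀ (D : Subset m) x t → D ⊆′ hSeq⁻¹ D x t
⊆′-hSeq⁻¹ []            _       _ = []
⊆′-hSeq⁻¹ (inside ∷ D)  x       t = keep (⊆′-hSeq⁻¹ D x t)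
⊆′-hSeq⁻¹ (outside ∷ D) zero    t = skip (⊆′-hSeq⁻¹ D (t 0) (t ∘ suc))
⊆′-hSeq⁻¹ (outside ∷ D) (suc x) t = add (⊆′-hSeq⁻¹ D x t)

hSeq-hSeq⁻¹ : ∀ (D : Subset m) x t z → (∀ r → z ≤ r → t r ≡ 0) →
              x + sumBelow z t + z ≡ ∣ ∁ D ∣ →
              let I = hSeq⁻¹ D x t in
              ∣ ∁ I ∣ ≡ z × hSeq D I 0 ≡ x × (∀ r → hSeq D I (suc r) ≡ t r)
hSeq-hSeq⁻¹ [] x t zero t≡0 x+0+0≡0 =
  refl , sym (m+n≡0⇒m≡0 x (m+n≡0⇒m≡0 (x + 0) x+0+0≡0)) , λ r → sym (t≡0 r z≤n)
hSeq-hSeq⁻¹ [] x t (suc z) t≡0 fits with m+n≡0⇒n≡0 (x + sumBelow (suc z) t) fits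
... | ()
hSeq-hSeq⁻¹ (inside ∷ D) x t z t≡0 fits = hSeq-hSeq⁻¹ D x t z t≡0 fits
hSeq-hSeq⁻¹ (outside ∷ D) zero t zero t≡0 ()
hSeq-hSeq⁻¹ (outside ∷ D) zero t (suc z) t≡0 fits
  with hSeq-hSeq⁻¹ D (t 0) (t ∘ suc) z (λ r z≤r → t≡0 (suc r) (s≤s z≤r))
                   (suc-injective (trans (sym (+-suc _ z)) fits))
... | ∣∁I∣≡z , head , tail = cong suc ∣∁I∣≡z , refl , λ { zero → head ; (suc r) → tail r }
hSeq-hSeq⁻¹ (outside ∷ D) (suc x) t z t≡0 fits
  with hSeq-hSeq⁻¹ D x t z t≡0 (suc-injective fits)
... | ∣∁I∣≡z , head , tail = ∣∁I∣≡z , cong suc head , tail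

∣p∩∅∣≡0 : (p : Subset m) → ∣ p ∩ tabulate (λ _ → outside) ∣ ≡ 0
∣p∩∅∣≡0 []            = refl
∣p∩∅∣≡0 (inside ∷ p)  = ∣p∩∅∣≡0 p
∣p∩∅∣≡0 (outside ∷ p) = ∣p∩∅∣≡0 p

count-rIdx : {D I : Subset m} → D ⊆′ I →
             ∀ r → ∣ (I ─ D) ∩ tabulate (λ i → rIdx I i ≡ᵇ r) ∣ ≡ hSeq D I r
count-rIdx []       r       = refl
count-rIdx (keep s) r       = count-rIdx s r
-- rIdx (inside ∷ I) zero reduces to ∣ ∁ I ∩ ∅ ∣
count-rIdx {I = inside ∷ I} (add s) zero    rewrite ∣p∩∅∣≡0 (∁ I) = cong suc (count-rIdx s zero)
count-rIdx {I = inside ∷ I} (add s) (suc r) rewrite ∣p∩∅∣≡0 (∁ I) = count-rIdx s (suc r)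
count-rIdx {D = _ ∷ D} {outside ∷ I} (skip s) zero = ∣p∩∅∣≡0 (I ─ D)
count-rIdx (skip s) (suc r) = count-rIdx s r

hVec-hSeq : {D I : Subset m} → D ⊆′ I →
            hVec (suc m) D I ≡ tabulate (λ r → hSeq D I (suc (toℕ r)))
hVec-hSeq s = tabulate-cong (λ r → count-rIdx s (suc (toℕ r)))

module _ {m K : ℕ} {D : Subset m} where

  ∣∁I∣≡m∸K : ∀ (I : Subset m) → ∣ I ∣ ≡ K → ∣ ∁ I ∣ ≡ m ∸ K
  ∣∁I∣≡m∸K I ∣I∣≡K = trans (∣∁p∣≡n∸∣p∣ I) (cong (m ∸_) ∣I∣≡K)

  hSeq-total-K : ∀ {I} → D ⊆′ I → ∣ I ∣ ≡ K →
                 hSeq D I 0 + sumBelow (m ∸ K) (hSeq D I ∘ suc) + ∣ D ∣ ≡ K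
  hSeq-total-K {I} s ∣I∣≡K =
    subst₂ (λ c k → hSeq D I 0 + sumBelow c (hSeq D I ∘ suc) + ∣ D ∣ ≡ k)
           (∣∁I∣≡m∸K I ∣I∣≡K) ∣I∣≡K (hSeq-total s)

  hVec-∈H : ∀ I → D ⊆ I → ∣ I ∣ ≡ K → InH (suc m) (suc K) ∣ D ∣ (hVec (suc m) D I)
  hVec-∈H I D⊆I ∣I∣≡K = subst (InH (suc m) (suc K) ∣ D ∣) (sym (hVec-hSeq s))
    (InHSeq⇒InH-tabulate (hSeq D I ∘ suc) (vanish , s≤s S+d≤K))
    where
    s = ⊆⇒⊆′ D⊆I
    vanish : ∀ r → m ∸ K ≤ r → hSeq D I (suc r) ≡ 0
    vanish r z≤r = hSeq-vanishes D I (suc r)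
      (s≤s (subst (_≤ r) (sym (∣∁I∣≡m∸K I ∣I∣≡K)) z≤r))
    S+d = sumBelow (m ∸ K) (hSeq D I ∘ suc) + ∣ D ∣
    S+d≤K : S+d ≤ K
    S+d≤K = subst (S+d ≤_) (trans (sym (+-assoc (hSeq D I 0) _ _)) (hSeq-total-K s ∣I∣≡K))
                  (m≤n+m S+d (hSeq D I 0))

  hVec-injective : ∀ I I′ → D ⊆ I → ∣ I ∣ ≡ K → D ⊆ I′ → ∣ I′ ∣ ≡ K →
                   hVec (suc m) D I ≡ hVec (suc m) D I′ → I ≡ I′
  hVec-injective I I′ D⊆I ∣I∣≡K D⊆I′ ∣I′∣≡K hI≡hI′ = hSeq-injective s s′ agree
    where
    s = ⊆⇒⊆′ D⊆I
    s′ = ⊆⇒⊆′ D⊆I′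
    h h′ : Vec ℕ (suc m)
    h = tabulate (λ r → hSeq D I (suc (toℕ r)))
    h′ = tabulate (λ r → hSeq D I′ (suc (toℕ r)))
    h≡h′ : h ≡ h′
    h≡h′ = trans (sym (hVec-hSeq s)) (trans hI≡hI′ (hVec-hSeq s′))
    tails : ∀ r → r < suc m → hSeq D I (suc r) ≡ hSeq D I′ (suc r)
    tails r r<1+m = begin
      hSeq D I (suc r)   ≡⟨ ‼-tabulate (hSeq D I ∘ suc) r<1+m ⟨
      h ‼ r              ≡⟨ cong (_‼ r) h≡h′ ⟩
      h′ ‼ r             ≡⟨ ‼-tabulate (hSeq D I′ ∘ suc) r<1+m ⟩
      hSeq D I′ (suc r)  ∎
      where open ≡-Reasoning
    S = sumBelow (m ∸ K) (hSeq D I ∘ suc)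
    S≡S′ : S ≡ sumBelow (m ∸ K) (hSeq D I′ ∘ suc)
    S≡S′ = sumBelow-cong (m ∸ K) (λ r r<z → tails r (m≤n⇒m≤1+n (≤-trans r<z (m∸n≤m m K))))
    totals : hSeq D I 0 + S + ∣ D ∣ ≡ hSeq D I′ 0 + S + ∣ D ∣
    totals = trans (hSeq-total-K s ∣I∣≡K) (trans (sym (hSeq-total-K s′ ∣I′∣≡K))
                   (cong (λ S′ → hSeq D I′ 0 + S′ + ∣ D ∣) (sym S≡S′)))
    head : hSeq D I 0 ≡ hSeq D I′ 0
    head = +-cancelʳ-≡ S _ _ (+-cancelʳ-≡ ∣ D ∣ _ _ totals)
    agree : ∀ r → r ≤ ∣ ∁ I ∣ → hSeq D I r ≡ hSeq D I′ r
    agree zero    _   = head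
    agree (suc r) r<c = tails r (m≤n⇒m≤1+n (≤-trans r<c (∣p∣≤n (∁ I))))

  hVec-surjective : K ≤ m → ∀ v → InH (suc m) (suc K) ∣ D ∣ v →
                    Σ (Subset m) λ I → D ⊆ I × ∣ I ∣ ≡ K × hVec (suc m) D I ≡ v
  hVec-surjective K≤m v v∈H = I , ⊆′⇒⊆ s , ∣I∣≡K , hI≡v
    where
    z = m ∸ K
    d = ∣ D ∣
    t = v ‼_
    S = sumBelow z t
    t∈HSeq = InH⇒InHSeq-‼ {suc m} {suc K} {d} v v∈H
    S+d≤K : S + d ≤ K
    S+d≤K = ≤-pred (proj₂ t∈HSeq)
    x = K ∸ (S + d)
    fits : x + S + z ≡ ∣ ∁ D ∣
    fits = begin
      x + S + z           ≡⟨ m+n∸n≡m (x + S + z) d ⟨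
      x + S + z + d ∸ d   ≡⟨ cong (_∸ d) (xy∙z≈xz∙y (x + S) z d) ⟩
      x + S + d + z ∸ d   ≡⟨ cong (λ a → a + z ∸ d) (trans (+-assoc x S d) (m∸n+n≡m S+d≤K)) ⟩
      K + z ∸ d           ≡⟨ cong (_∸ d) (m+[n∸m]≡n K≤m) ⟩
      m ∸ d               ≡⟨ ∣∁p∣≡n∸∣p∣ D ⟨
      ∣ ∁ D ∣             ∎
      where open ≡-Reasoning
    I = hSeq⁻¹ D x t
    s = ⊆′-hSeq⁻¹ D x t
    decoded = hSeq-hSeq⁻¹ D x t z (proj₁ t∈HSeq) fits
    ∣I∣≡K : ∣ I ∣ ≡ K
    ∣I∣≡K = ∸-cancelˡ-≡ (∣p∣≤n I) K≤m (trans (sym (∣∁p∣≡n∸∣p∣ I)) (proj₁ decoded))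
    hI≡v : hVec (suc m) D I ≡ v
    hI≡v = trans (hVec-hSeq s)
                 (trans (tabulate-cong (proj₂ (proj₂ decoded) ∘ toℕ)) (tabulate-‼ v))

hVec-bijOnto : ∀ {m K} (D : Subset m) → K ≤ m → BijOnto (suc m) (suc K) D
hVec-bijOnto D K≤m = hVec-∈H , hVec-injective , hVec-surjective K≤m

lemma3p17 : (n k : ℕ) (lam : List ℕ) → lam ⊢ n → 1 ≤ k → k ≤ n →
    (∀ S → SYT n lam S → BijOnto n k (DsiC n S))
    × (∀ C → CCT lam C → BijOnto n k (DspC n C))
lemma3p17 (suc m) (suc K) _ _ _ (s≤s K≤m) =
  (λ S _ → hVec-bijOnto (DsiC (suc m) S) K≤m) , (λ C _ → hVec-bijOnto (DspC (suc m) C) K≤m)
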